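{- Let $H$ and $F$ be fixed graphs with $|V(H)|\ge |V(F)|$ such that $H$ does not contain $F$ as a subgraph. Then $\mathrm{ex}_{\mathrm{re}}(n,H,F)=\Theta(n^{|V(H)|})$ as $n\to\infty$.
   Context: All graphs are finite and simple. A copy of a graph $H$ in a graph $G$ is a (not necessarily induced) subgraph of $G$ isomorphic to $H$. Two subgraphs $G'$ and $G''$ of $G$ align in $G$ if $V(G')\subseteq V(G'')$ or $V(G'')\subseteq V(G')$. $\mathcal{N}_{\mathrm{re}}(H,F,G)$ denotes the number of copies of $H$ in $G$ that do not align with any copy of $F$ in $G$, and $\mathrm{ex}_{\mathrm{re}}(n,H,F)$ is the maximum of $\mathcal{N}_{\mathrm{re}}(H,F,G)$ over all $n$-vertex graphs $G$. -}

module Defs where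

open import Data.Bool using (Bool; true; false; _∧_; _∨_; not; if_then_else_)
open import Data.Nat using (ℕ; zero; suc; _⊔_)
open import Data.Fin using (Fin)
import Data.Fin as Fin
open import Data.Vec using (Vec; []; _∷_; lookup)
open import Data.List using (List; []; _∷_; map; concatMap; allFin; filterᵇ; length; foldr; cartesianProduct)
open import Data.Bool.ListAction using (all; any)
open import Data.Product using (_×_; _,_; proj₁; proj₂)
open import Relation.Nullary.Decidable using (⌊_⌋)
open import Relation.Binary.PropositionalEquality using (_≡_)

_⇒ᵇ_ : Bool → Bool → Bool
a ⇒ᵇ b = not a ∨ b

_==_ : ∀ {n} → Fin n → Fin n → Bool
i == j = ⌊ i Fin.≟ j ⌋

allVecs : ∀ {a} {A : Set a} → List A → (n : ℕ) → List (Vec A n)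
allVecs xs zero = [] ∷ []
allVecs xs (suc n) = concatMap (λ x → map (x ∷_) (allVecs xs n)) xs

bools : List Bool
bools = true ∷ false ∷ []

Mat : ℕ → Set
Mat n = Vec (Vec Bool n) n

entry : ∀ {n} → Mat n → Fin n → Fin n → Bool
entry M i j = lookup (lookup M i) j

allMats : (n : ℕ) → List (Mat n)
allMats n = allVecs (allVecs bools n) n

isGraphᵇ : ∀ {n} → Mat n → Bool
isGraphᵇ {n} M =
  all (λ i → not (entry M i i) ∧ all (λ j → entry M i j ⇒ᵇ entry M j i) (allFin n)) (allFin n)

record Graph (n : ℕ) : Set where
  field
    adj     : Mat n
    isGraph : isGraphᵇ adj ≡ true
open Graph public

-- A subgraph of a graph on Fin n: a vertex set S and an edge relation E.
-- (Represented canonically: E has no entries outside S.)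
Sub : ℕ → Set
Sub n = Vec Bool n × Mat n

allSubs : (n : ℕ) → List (Sub n)
allSubs n = cartesianProduct (allVecs bools n) (allMats n)

isSubgraphᵇ : ∀ {n} → Mat n → Sub n → Bool
isSubgraphᵇ {n} G (S , E) =
  all (λ i → all (λ j →
      (entry E i j ⇒ᵇ (entry G i j ∧ lookup S i ∧ lookup S j))
    ∧ (entry E i j ⇒ᵇ entry E j i)) (allFin n)) (allFin n)

isIsoOntoᵇ : ∀ {k n} → Mat k → Sub n → Vec (Fin n) k → Bool
isIsoOntoᵇ {k} {n} K (S , E) φ =
     all (λ a → all (λ b → (lookup φ a == lookup φ b) ⇒ᵇ (a == b)) (allFin k)) (allFin k)
   ∧ all (λ i → eqB (lookup S i) (any (λ a → lookup φ a == i) (allFin k))) (allFin n)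
   ∧ all (λ a → all (λ b → eqB (entry K a b) (entry E (lookup φ a) (lookup φ b))) (allFin k)) (allFin k)
  where
  eqB : Bool → Bool → Bool
  eqB x y = (x ⇒ᵇ y) ∧ (y ⇒ᵇ x)

isCopyᵇ : ∀ {k n} → Graph k → Mat n → Sub n → Bool
isCopyᵇ {k} {n} K G s =
  isSubgraphᵇ G s ∧ any (isIsoOntoᵇ (adj K) s) (allVecs (allFin n) k)

-- The list of all copies of K in G (each copy listed exactly once)
copies : ∀ {k n} → Graph k → Mat n → List (Sub n)
copies {k} {n} K G = filterᵇ (isCopyᵇ K G) (allSubs n)

vsubsetᵇ : ∀ {n} → Sub n → Sub n → Bool
vsubsetᵇ {n} (S , _) (T , _) = all (λ i → lookup S i ⇒ᵇ lookup T i) (allFin n)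

alignᵇ : ∀ {n} → Sub n → Sub n → Bool
alignᵇ s t = vsubsetᵇ s t ∨ vsubsetᵇ t s

allGraphMats : (n : ℕ) → List (Mat n)
allGraphMats n = filterᵇ isGraphᵇ (allMats n)

Nreᴹ : ∀ {h f n} → Graph h → Graph f → Mat n → ℕ
Nreᴹ H F G =
  length (filterᵇ (λ c → not (any (alignᵇ c) (copies F G))) (copies H G))

exre : ∀ {h f} → (n : ℕ) → Graph h → Graph f → ℕ
exre n H F = foldr _⊔_ 0 (map (Nreᴹ H F) (allGraphMats n))

{-# OPTIONS --safe #-}
module Submission where

-- Upper bound: a copy of H in a graph on n vertices is determined by where an isomorphism sends
-- the h vertices of H, so there are at most n ^ h copies.
-- Lower bound: blow H up to n vertices, vertex i playing the role of vertex (i mod h) of H. Each of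
-- the ⌊n/h⌋ ^ h transversals (one vertex from every class) spans a copy c of H. A copy of F inside
-- V(c) would project to a copy of F in H; a copy of F containing V(c) has f ≤ h vertices, so it
-- equals V(c) and we are in the first case. Hence no transversal copy aligns with a copy of F,
-- and n ≤ 2h⌊n/h⌋ for n ≥ h turns ⌊n/h⌋ ^ h into the constant (2h) ^ h.

open import Defs
open import Data.Bool using (Bool; true; false; T; not; _∧_)
open import Data.Bool.ListAction using (all; any)
open import Data.Bool.Properties using (T-∧; T-∨; T-≡)
open import Data.Empty using (⊥-elim)
open import Data.Fin using (Fin; toℕ; inject≤; combine; punchOut)
import Data.Fin as Fin
open import Data.Fin.Properties
  using (toℕ-injective; toℕ-inject≤; toℕ-combine; toℕ-fromℕ<; toℕ<n; inject≤-injective; combine-injectiveˡ;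
         any?; _≟_; injective⇒≤; punchOut-injective)
open import Data.List
  using (List; []; _∷_; map; concatMap; cartesianProductWith; allFin; filterᵇ; length; foldr; _++_)
open import Data.List.Properties using (length-++; length-map; length-tabulate; length-filter)
open import Data.List.Membership.Propositional using (_∈_; lose; find)
open import Data.List.Membership.Propositional.Properties
  using (∈-allFin; ∈-∃++; ∈-++⁻; ∈-++⁺ˡ; ∈-++⁺ʳ; ∈-filter⁺; ∈-filter⁻; ∈-map⁺; ∈-map⁻;
         ∈-cartesianProduct⁺; ∈-cartesianProductWith⁺)
import Data.List.Relation.Unary.All as All
open import Data.List.Relation.Unary.All.Properties using (all⁺; all⁻; tabulate⁺)
import Data.List.Relation.Unary.Any as Any
open import Data.List.Relation.Unary.Any using (here; there)
open import Data.List.Relation.Unary.Any.Properties using (any⁺; any⁻; ¬Any[])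
open import Data.List.Relation.Unary.Unique.Propositional using (Unique; []; _∷_)
import Data.List.Relation.Unary.Unique.Propositional.Properties as Unique
open import Data.Nat using (ℕ; zero; suc; _≤_; _+_; _*_; _^_; _⊔_; _%_; _/_; NonZero; >-nonZero; z≤n; s≤s)
open import Data.Nat.Properties
  using (≤-trans; ≤-reflexive; <-irrefl; <⇒≤; +-suc; ⊔-lub; m≤m⊔n; m≤n⊔m; *-identityˡ; *-monoʳ-≤;
         ^-monoˡ-≤; +-monoˡ-≤; m≤n*m; module ≤-Reasoning)
open import Data.Nat.DivMod using (_mod_; m/n*n≤m; %-remove-+ˡ; m<n⇒m%n≡m; m≡m%n+[m/n]*n; m%n<n; m≥n⇒m/n>0)
open import Data.Nat.Divisibility using (m∣m*n)
open import Data.Nat.Solver using (module +-*-Solver)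
open import Data.Product using (Σ; ∃; ∃₂; _×_; _,_; proj₁; proj₂)
open import Data.Sum using (inj₁; inj₂)
open import Data.Vec using (Vec; []; _∷_; lookup; tabulate)
import Data.Vec as Vec
open import Data.Vec.Properties using (lookup∘tabulate; tabulate∘lookup; tabulate-cong; lookup-map)
open import Function using (_∘_)
open import Function.Bundles using (_⇔_; mk⇔; Equivalence)
open import Function.Definitions using (Injective)
open import Function.Properties.Equivalence using () renaming (refl to ⇔-refl; trans to ⇔-trans; sym to ⇔-sym)
open import Relation.Nullary using (¬_; yes; no)
open import Relation.Nullary.Decidable using (T?; toWitness; fromWitness)
open import Relation.Binary.PropositionalEquality
  using (_≡_; _≢_; refl; sym; trans; cong; cong₂; subst; subst₂; module ≡-Reasoning)

open Equivalence using (to; from)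

T-not : ∀ {a} → T (not a) ⇔ (¬ T a)
T-not {true}  = mk⇔ (λ ()) (λ ¬t → ¬t _)
T-not {false} = mk⇔ (λ _ ()) (λ _ → _)

T-⇒ᵇ : ∀ {a b} → T (a ⇒ᵇ b) ⇔ (T a → T b)
T-⇒ᵇ {true}  = mk⇔ (λ t _ → t) (λ f → f _)
T-⇒ᵇ {false} = mk⇔ (λ _ ()) (λ _ → _)

T-⇔ᵇ : ∀ {a b} → T ((a ⇒ᵇ b) ∧ (b ⇒ᵇ a)) ⇔ (T a ⇔ T b)
T-⇔ᵇ {true}  {true}  = mk⇔ (λ _ → mk⇔ _ _) _
T-⇔ᵇ {true}  {false} = mk⇔ (λ ()) (λ e → to e _)
T-⇔ᵇ {false} {true}  = mk⇔ (λ ()) (λ e → from e _)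
T-⇔ᵇ {false} {false} = mk⇔ (λ _ → mk⇔ (λ ()) (λ ())) _

T-injective : ∀ {a b} → T a ⇔ T b → a ≡ b
T-injective {true}  {true}  _ = refl
T-injective {true}  {false} e = ⊥-elim (to e _)
T-injective {false} {true}  e = ⊥-elim (from e _)
T-injective {false} {false} _ = refl

T-== : ∀ {n} {i j : Fin n} → T (i == j) ⇔ (i ≡ j)
T-== = mk⇔ toWitness fromWitness

module _ {n : ℕ} (p : Fin n → Bool) where

  T-allFin : T (all p (allFin n)) ⇔ (∀ i → T (p i))
  T-allFin = mk⇔ (λ t i → All.lookup (all⁺ p _ t) (∈-allFin i)) (λ f → all⁻ p (tabulate⁺ f))

  T-anyFin : T (any p (allFin n)) ⇔ (∃ λ i → T (p i))
  T-anyFin = mk⇔ (λ t → Any.satisfied (any⁻ p (allFin n) t))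
                 (λ (i , t) → any⁺ {xs = allFin n} p (lose (∈-allFin i) t))

T-allFin² : ∀ {m n} (p : Fin m → Fin n → Bool) →
  T (all (λ i → all (p i) (allFin n)) (allFin m)) ⇔ (∀ i j → T (p i j))
T-allFin² p = mk⇔ (λ t i → to (T-allFin (p i)) (to (T-allFin _) t i))
                  (λ f → from (T-allFin _) (λ i → from (T-allFin (p i)) (f i)))

T-not-any : ∀ {a} {A : Set a} {p : A → Bool} {xs} →
  (∀ {x} → x ∈ xs → ¬ T (p x)) → T (not (any p xs))
T-not-any {p = p} {xs} none = from T-not λ t → let (x , x∈xs , px) = find (any⁻ p xs t) in none x∈xs px

unique-⊆⇒length≤ : ∀ {a} {A : Set a} {xs ys : List A} → Unique xs → (∀ {x} → x ∈ xs → x ∈ ys) →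
  length xs ≤ length ys
unique-⊆⇒length≤ {xs = []}     _            _     = z≤n
unique-⊆⇒length≤ {xs = x ∷ xs} (x∉xs ∷ uxs) xs⊆ys with ∈-∃++ (xs⊆ys (here refl))
... | us , vs , refl =
  subst (suc (length xs) ≤_) (sym length-us++x∷vs) (s≤s (unique-⊆⇒length≤ uxs xs⊆us++vs))
  where
  length-us++x∷vs : length (us ++ x ∷ vs) ≡ suc (length (us ++ vs))
  length-us++x∷vs rewrite length-++ us {x ∷ vs} | length-++ us {vs} = +-suc (length us) (length vs)
  xs⊆us++vs : ∀ {y} → y ∈ xs → y ∈ us ++ vs
  xs⊆us++vs y∈xs with ∈-++⁻ us (xs⊆ys (there y∈xs))
  ... | inj₁ y∈us         = ∈-++⁺ˡ y∈us
  ... | inj₂ (here refl)  = ⊥-elim (All.lookup x∉xs y∈xs refl)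
  ... | inj₂ (there y∈vs) = ∈-++⁺ʳ us y∈vs

foldr-⊔-lub : ∀ {b} (xs : List ℕ) → (∀ {x} → x ∈ xs → x ≤ b) → foldr _⊔_ 0 xs ≤ b
foldr-⊔-lub []       _    = z≤n
foldr-⊔-lub (x ∷ xs) xs≤b = ⊔-lub (xs≤b (here refl)) (foldr-⊔-lub xs (xs≤b ∘ there))

∈⇒≤foldr-⊔ : ∀ {x} {xs : List ℕ} → x ∈ xs → x ≤ foldr _⊔_ 0 xs
∈⇒≤foldr-⊔ {xs = x ∷ xs} (here refl)  = m≤m⊔n x _
∈⇒≤foldr-⊔ {xs = y ∷ xs} (there x∈xs) = ≤-trans (∈⇒≤foldr-⊔ x∈xs) (m≤n⊔m y _)

length-allFin : ∀ n → length (allFin n) ≡ n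
length-allFin n = length-tabulate {n = n} (λ i → i)

module _ {a b c} {A : Set a} {B : Set b} {C : Set c} (f : A → B → C) where

  concatMap-map≡cartesianProductWith : ∀ xs ys →
    concatMap (λ x → map (f x) ys) xs ≡ cartesianProductWith f xs ys
  concatMap-map≡cartesianProductWith []       ys = refl
  concatMap-map≡cartesianProductWith (x ∷ xs) ys =
    cong (map (f x) ys ++_) (concatMap-map≡cartesianProductWith xs ys)

  length-cartesianProductWith : ∀ xs ys → length (cartesianProductWith f xs ys) ≡ length xs * length ys
  length-cartesianProductWith []       ys = refl
  length-cartesianProductWith (x ∷ xs) ys = trans (length-++ (map (f x) ys))
    (cong₂ _+_ (length-map (f x) ys) (length-cartesianProductWith xs ys))

module _ {a} {A : Set a} (xs : List A) where

  allVecs-suc : ∀ n → allVecs xs (suc n) ≡ cartesianProductWith _∷_ xs (allVecs xs n)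
  allVecs-suc n = concatMap-map≡cartesianProductWith _∷_ xs (allVecs xs n)

  length-allVecs : ∀ n → length (allVecs xs n) ≡ length xs ^ n
  length-allVecs zero    = refl
  length-allVecs (suc n) = begin
    length (allVecs xs (suc n))                          ≡⟨ cong length (allVecs-suc n) ⟩
    length (cartesianProductWith _∷_ xs (allVecs xs n))  ≡⟨ length-cartesianProductWith _∷_ xs _ ⟩
    length xs * length (allVecs xs n)                    ≡⟨ cong (length xs *_) (length-allVecs n) ⟩
    length xs ^ suc n                                    ∎
    where open ≡-Reasoning

  ∈-allVecs : ∀ {n} (v : Vec A n) → (∀ i → lookup v i ∈ xs) → v ∈ allVecs xs n
  ∈-allVecs []      _    = here refl
  ∈-allVecs (x ∷ v) v⊆xs = subst (x ∷ v ∈_) (sym (allVecs-suc _))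
    (∈-cartesianProductWith⁺ _∷_ (v⊆xs Fin.zero) (∈-allVecs v (v⊆xs ∘ Fin.suc)))

  allVecs-unique : Unique xs → ∀ n → Unique (allVecs xs n)
  allVecs-unique _   zero    = All.[] ∷ []
  allVecs-unique uxs (suc n) = subst Unique (sym (allVecs-suc n))
    (Unique.cartesianProductWith⁺ _∷_ (λ { refl → refl , refl }) uxs (allVecs-unique uxs n))

lookup-extensionality : ∀ {a} {A : Set a} {n} {u v : Vec A n} →
  (∀ i → lookup u i ≡ lookup v i) → u ≡ v
lookup-extensionality {u = u} {v} u≗v =
  trans (sym (tabulate∘lookup u)) (trans (tabulate-cong u≗v) (tabulate∘lookup v))

-- A missed b could be punched out of the codomain, injecting Fin p into Fin (q - 1).
injective⇒surjective : ∀ {p q} {κ : Fin p → Fin q} → Injective _≡_ _≡_ κ → q ≤ p →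
  ∀ b → ∃ λ a → κ a ≡ b
injective⇒surjective {p} {suc q} {κ} κ-inj q≤p b with any? (λ a → κ a ≟ b)
... | yes κa≡b = κa≡b
... | no  ∄a   = ⊥-elim (<-irrefl refl (≤-trans q≤p (injective⇒≤ κ′-inj)))
  where
  κa≢b : ∀ a → b ≢ κ a
  κa≢b a b≡κa = ∄a (a , sym b≡κa)
  κ′ : Fin p → Fin q
  κ′ a = punchOut (κa≢b a)
  κ′-inj : Injective _≡_ _≡_ κ′
  κ′-inj = κ-inj ∘ punchOut-injective (κa≢b _) (κa≢b _)

⊆-image⇒⊇-image : ∀ {p q} {A : Set} {φ : Fin p → A} {ψ : Fin q → A} → q ≤ p → Injective _≡_ _≡_ φ →
  (∀ a → ∃ λ b → ψ b ≡ φ a) → ∀ b → ∃ λ a → φ a ≡ ψ b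
⊆-image⇒⊇-image {φ = φ} {ψ} q≤p φ-inj φ⊆ψ b =
  let (a , κa≡b) = injective⇒surjective κ-inj q≤p b
  in a , trans (sym (proj₂ (φ⊆ψ a))) (cong ψ κa≡b)
  where
  κ-inj : Injective _≡_ _≡_ (proj₁ ∘ φ⊆ψ)
  κ-inj {a} {a′} κa≡κa′ =
    φ-inj (trans (sym (proj₂ (φ⊆ψ a))) (trans (cong ψ κa≡κa′) (proj₂ (φ⊆ψ a′))))

-- Graphs, subgraphs and copies

Adj : ∀ {n} → Mat n → Fin n → Fin n → Set
Adj M i j = T (entry M i j)

_∈ᵛ_ : ∀ {n} → Fin n → Vec Bool n → Set
i ∈ᵛ S = T (lookup S i)

record IsGraph {n} (M : Mat n) : Set where
  field
    irreflexive : ∀ i → ¬ Adj M i i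
    symmetric   : ∀ {i j} → Adj M i j → Adj M j i

isGraphᵇ⇔ : ∀ {n} {M : Mat n} → T (isGraphᵇ M) ⇔ IsGraph M
isGraphᵇ⇔ {n} {M} = mk⇔ decode encode
  where
  decode : T (isGraphᵇ M) → IsGraph M
  decode t = record
    { irreflexive = λ i → to T-not (proj₁ (row i))
    ; symmetric   = λ {i} {j} → to T-⇒ᵇ (to (T-allFin _) (proj₂ (row i)) j)
    }
    where
    row : ∀ i → T (not (entry M i i)) × T (all (λ j → entry M i j ⇒ᵇ entry M j i) (allFin n))
    row i = to T-∧ (to (T-allFin _) t i)
  encode : IsGraph M → T (isGraphᵇ M)
  encode g = from (T-allFin _) λ i →
    from T-∧ (from T-not (irreflexive i) , from (T-allFin _) (λ j → from T-⇒ᵇ (symmetric {i} {j})))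
    where open IsGraph g

Graph-isGraph : ∀ {k} (K : Graph k) → IsGraph (adj K)
Graph-isGraph K = to isGraphᵇ⇔ (from T-≡ (isGraph K))

record IsSubgraph {n} (G : Mat n) (S : Vec Bool n) (E : Mat n) : Set where
  field
    edge⇒adj  : ∀ {i j} → Adj E i j → Adj G i j
    edge⇒∈    : ∀ {i j} → Adj E i j → i ∈ᵛ S × j ∈ᵛ S
    symmetric : ∀ {i j} → Adj E i j → Adj E j i

isSubgraphᵇ⇔ : ∀ {n} {G : Mat n} {S E} → T (isSubgraphᵇ G (S , E)) ⇔ IsSubgraph G S E
isSubgraphᵇ⇔ {n} {G} {S} {E} = mk⇔ decode encode
  where
  decode : T (isSubgraphᵇ G (S , E)) → IsSubgraph G S E
  decode t = record
    { edge⇒adj  = λ e → proj₁ (inside e)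
    ; edge⇒∈    = λ e → to T-∧ (proj₂ (inside e))
    ; symmetric = λ {i} {j} → to T-⇒ᵇ (proj₂ (cell i j))
    }
    where
    cell : ∀ i j → T (entry E i j ⇒ᵇ (entry G i j ∧ lookup S i ∧ lookup S j))
                 × T (entry E i j ⇒ᵇ entry E j i)
    cell i j = to T-∧ (to (T-allFin² _) t i j)
    inside : ∀ {i j} → Adj E i j → Adj G i j × T (lookup S i ∧ lookup S j)
    inside {i} {j} e = to T-∧ (to T-⇒ᵇ (proj₁ (cell i j)) e)
  encode : IsSubgraph G S E → T (isSubgraphᵇ G (S , E))
  encode s = from (T-allFin² _) λ i j →
    from T-∧ ( from T-⇒ᵇ (λ e → from T-∧ (edge⇒adj {i} {j} e , from T-∧ (edge⇒∈ {i} {j} e)))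
             , from T-⇒ᵇ (symmetric {i} {j}))
    where open IsSubgraph s

T-∈image : ∀ {k n} (φ : Vec (Fin n) k) i →
  T (any (λ a → lookup φ a == i) (allFin k)) ⇔ (∃ λ a → lookup φ a ≡ i)
T-∈image φ i = mk⇔ (λ t → let (a , e) = to (T-anyFin _) t in a , to T-== e)
                   (λ (a , e) → from (T-anyFin _) (a , from T-== e))

record IsIsoOnto {k n} (K : Mat k) (S : Vec Bool n) (E : Mat n) (φ : Vec (Fin n) k) : Set where
  field
    injective : Injective _≡_ _≡_ (lookup φ)
    onto      : ∀ i → i ∈ᵛ S ⇔ (∃ λ a → lookup φ a ≡ i)
    adj⇔      : ∀ a b → Adj K a b ⇔ Adj E (lookup φ a) (lookup φ b)

isIsoOntoᵇ⇔ : ∀ {k n} {K : Mat k} {S E} {φ : Vec (Fin n) k} →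
  T (isIsoOntoᵇ K (S , E) φ) ⇔ IsIsoOnto K S E φ
isIsoOntoᵇ⇔ {k} {n} {K} {S} {E} {φ} = mk⇔ decode encode
  where
  injectiveᵇ ontoᵇ : Bool
  injectiveᵇ = all (λ a → all (λ b → (lookup φ a == lookup φ b) ⇒ᵇ (a == b)) (allFin k)) (allFin k)
  ontoᵇ = all (λ i → (lookup S i ⇒ᵇ any (λ a → lookup φ a == i) (allFin k))
                   ∧ (any (λ a → lookup φ a == i) (allFin k) ⇒ᵇ lookup S i)) (allFin n)
  decode : T (isIsoOntoᵇ K (S , E) φ) → IsIsoOnto K S E φ
  decode t = record
    { injective = λ {a} {b} e → to T-== (to T-⇒ᵇ (to (T-allFin² _) t₁ a b) (from T-== e))
    ; onto      = λ i → ⇔-trans (to T-⇔ᵇ (to (T-allFin _) t₂ i)) (T-∈image φ i)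
    ; adj⇔      = λ a b → to T-⇔ᵇ (to (T-allFin² _) t₃ a b)
    }
    where
    t₁ = proj₁ (to (T-∧ {injectiveᵇ}) t)
    t₂ = proj₁ (to (T-∧ {ontoᵇ}) (proj₂ (to (T-∧ {injectiveᵇ}) t)))
    t₃ = proj₂ (to (T-∧ {ontoᵇ}) (proj₂ (to (T-∧ {injectiveᵇ}) t)))
  encode : IsIsoOnto K S E φ → T (isIsoOntoᵇ K (S , E) φ)
  encode iso = from (T-∧ {injectiveᵇ})
    ( from (T-allFin² _) (λ a b → from T-⇒ᵇ (λ e → from (T-== {i = a} {b}) (injective (to T-== e))))
    , from (T-∧ {ontoᵇ})
      ( from (T-allFin _) (λ i → from T-⇔ᵇ (⇔-trans (onto i) (⇔-sym (T-∈image φ i))))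
      , from (T-allFin² _) (λ a b → from T-⇔ᵇ (adj⇔ a b))))
    where open IsIsoOnto iso

isCopyᵇ⇔ : ∀ {k n} {K : Graph k} {G : Mat n} {S E} →
  T (isCopyᵇ K G (S , E)) ⇔ (IsSubgraph G S E × ∃ λ φ → IsIsoOnto (adj K) S E φ)
isCopyᵇ⇔ {k} {n} {K} {G} {S} {E} = mk⇔ decode encode
  where
  decode : T (isCopyᵇ K G (S , E)) → IsSubgraph G S E × ∃ λ φ → IsIsoOnto (adj K) S E φ
  decode t with to (T-∧ {isSubgraphᵇ G (S , E)}) t
  ... | sub , iso with Any.satisfied (any⁻ _ (allVecs (allFin n) k) iso)
  ... | φ , isoᵇ = to (isSubgraphᵇ⇔ {G = G}) sub , φ , to (isIsoOntoᵇ⇔ {K = adj K}) isoᵇ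
  encode : IsSubgraph G S E × (∃ λ φ → IsIsoOnto (adj K) S E φ) → T (isCopyᵇ K G (S , E))
  encode (sub , φ , iso) = from T-∧ (from (isSubgraphᵇ⇔ {G = G}) sub ,
    any⁺ _ (lose (∈-allVecs (allFin n) φ (λ _ → ∈-allFin _)) (from (isIsoOntoᵇ⇔ {K = adj K}) iso)))

∈-bools : ∀ b → b ∈ bools
∈-bools true  = here refl
∈-bools false = there (here refl)

bools-unique : Unique bools
bools-unique = ((λ ()) All.∷ All.[]) ∷ All.[] ∷ []

∈-allMats : ∀ {n} (M : Mat n) → M ∈ allMats n
∈-allMats M = ∈-allVecs _ M (λ _ → ∈-allVecs bools _ (λ _ → ∈-bools _))

∈-allSubs : ∀ {n} (s : Sub n) → s ∈ allSubs n
∈-allSubs (S , E) = ∈-cartesianProduct⁺ (∈-allVecs bools S (λ _ → ∈-bools _)) (∈-allMats E)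

allSubs-unique : ∀ n → Unique (allSubs n)
allSubs-unique n = Unique.cartesianProduct⁺ (allVecs-unique bools bools-unique n)
  (allVecs-unique _ (allVecs-unique bools bools-unique n) n)

copies-unique : ∀ {k n} (K : Graph k) (G : Mat n) → Unique (copies K G)
copies-unique K G = Unique.filter⁺ (T? ∘ isCopyᵇ K G) (allSubs-unique _)

-- Copies as images of embeddings

tabulateMat : ∀ {n} → (Fin n → Fin n → Bool) → Mat n
tabulateMat f = tabulate λ i → tabulate λ j → f i j

entry-tabulateMat : ∀ {n} (f : Fin n → Fin n → Bool) i j → entry (tabulateMat f) i j ≡ f i j
entry-tabulateMat f i j =
  trans (cong (λ row → lookup row j) (lookup∘tabulate _ i)) (lookup∘tabulate (f i) j)

vertices : ∀ {k n} → Vec (Fin n) k → Vec Bool n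
vertices {k} φ = tabulate λ i → any (λ a → lookup φ a == i) (allFin k)

edges : ∀ {k n} → Mat k → Vec (Fin n) k → Mat n
edges {k} K φ = tabulateMat λ i j →
  any (λ a → any (λ b → (lookup φ a == i) ∧ (lookup φ b == j) ∧ entry K a b) (allFin k)) (allFin k)

image : ∀ {k n} → Mat k → Vec (Fin n) k → Sub n
image K φ = vertices φ , edges K φ

∈-vertices : ∀ {k n} (φ : Vec (Fin n) k) i → i ∈ᵛ vertices φ ⇔ (∃ λ a → lookup φ a ≡ i)
∈-vertices φ i =
  subst (λ b → T b ⇔ (∃ λ a → lookup φ a ≡ i)) (sym (lookup∘tabulate _ i)) (T-∈image φ i)

Adj-edges : ∀ {k n} (K : Mat k) (φ : Vec (Fin n) k) i j →
  Adj (edges K φ) i j ⇔ (∃₂ λ a b → lookup φ a ≡ i × lookup φ b ≡ j × Adj K a b)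
Adj-edges {k} K φ i j =
  subst (λ b → T b ⇔ (∃₂ λ a b → lookup φ a ≡ i × lookup φ b ≡ j × Adj K a b))
    (sym (entry-tabulateMat _ i j)) (mk⇔ decode encode)
  where
  inner : Fin k → Bool
  inner a = any (λ b → (lookup φ a == i) ∧ (lookup φ b == j) ∧ entry K a b) (allFin k)
  decode : T (any inner (allFin k)) → ∃₂ λ a b → lookup φ a ≡ i × lookup φ b ≡ j × Adj K a b
  decode t with to (T-anyFin _) t
  ... | a , t′ with to (T-anyFin _) t′
  ... | b , t″ with to (T-∧ {lookup φ a == i}) t″
  ... | φa≡i , t‴ with to (T-∧ {lookup φ b == j}) t‴
  ... | φb≡j , Kab = a , b , to T-== φa≡i , to T-== φb≡j , Kab
  encode : (∃₂ λ a b → lookup φ a ≡ i × lookup φ b ≡ j × Adj K a b) → T (any inner (allFin k))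
  encode (a , b , φa≡i , φb≡j , Kab) = from (T-anyFin _)
    (a , from (T-anyFin _) (b , from T-∧ (from T-== φa≡i , from T-∧ (from T-== φb≡j , Kab))))

record IsEmbedding {k n} (K : Mat k) (G : Mat n) (φ : Vec (Fin n) k) : Set where
  field
    injective   : Injective _≡_ _≡_ (lookup φ)
    homomorphic : ∀ {a b} → Adj K a b → Adj G (lookup φ a) (lookup φ b)

module _ {k n} {K : Mat k} {φ : Vec (Fin n) k} where

  image-isIsoOnto : Injective _≡_ _≡_ (lookup φ) → IsIsoOnto K (vertices φ) (edges K φ) φ
  image-isIsoOnto inj = record
    { injective = inj
    ; onto      = ∈-vertices φ
    ; adj⇔      = λ a b → mk⇔ (λ Kab → from (Adj-edges K φ _ _) (a , b , refl , refl , Kab))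
                              (reflect a b)
    }
    where
    reflect : ∀ a b → Adj (edges K φ) (lookup φ a) (lookup φ b) → Adj K a b
    reflect a b e with to (Adj-edges K φ _ _) e
    ... | a′ , b′ , φa′≡φa , φb′≡φb , Ka′b′ = subst₂ (Adj K) (inj φa′≡φa) (inj φb′≡φb) Ka′b′

  image-isSubgraph : ∀ {G : Mat n} → IsGraph K → IsEmbedding K G φ → IsSubgraph G (vertices φ) (edges K φ)
  image-isSubgraph {G} graph emb = record
    { edge⇒adj  = edge⇒adj ∘ to (Adj-edges K φ _ _)
    ; edge⇒∈    = edge⇒∈ ∘ to (Adj-edges K φ _ _)
    ; symmetric = symmetric ∘ to (Adj-edges K φ _ _)
    }
    where
    open IsEmbedding emb
    Edge : Fin n → Fin n → Set
    Edge i j = ∃₂ λ a b → lookup φ a ≡ i × lookup φ b ≡ j × Adj K a b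
    edge⇒adj : ∀ {i j} → Edge i j → Adj G i j
    edge⇒adj (a , b , refl , refl , Kab) = homomorphic Kab
    edge⇒∈ : ∀ {i j} → Edge i j → i ∈ᵛ vertices φ × j ∈ᵛ vertices φ
    edge⇒∈ (a , b , refl , refl , _) =
      from (∈-vertices φ _) (a , refl) , from (∈-vertices φ _) (b , refl)
    symmetric : ∀ {i j} → Edge i j → Adj (edges K φ) j i
    symmetric (a , b , refl , refl , Kab) =
      from (Adj-edges K φ _ _) (b , a , refl , refl , IsGraph.symmetric graph Kab)

  isIsoOnto⇒≡image : ∀ {G : Mat n} {S E} → IsSubgraph G S E → IsIsoOnto K S E φ → (S , E) ≡ image K φ
  isIsoOnto⇒≡image {G} {S} {E} sub iso = cong₂ _,_
    (lookup-extensionality λ i → T-injective (⇔-trans (onto i) (⇔-sym (∈-vertices φ i))))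
    (lookup-extensionality λ i → lookup-extensionality λ j → T-injective (mk⇔ (forth i j) back))
    where
    open IsSubgraph sub
    open IsIsoOnto iso
    forth : ∀ i j → Adj E i j → Adj (edges K φ) i j
    forth i j e with to (onto i) (proj₁ (edge⇒∈ e)) | to (onto j) (proj₂ (edge⇒∈ e))
    ... | a , refl | b , refl = from (Adj-edges K φ _ _) (a , b , refl , refl , from (adj⇔ a b) e)
    back : ∀ {i j} → Adj (edges K φ) i j → Adj E i j
    back e with to (Adj-edges K φ _ _) e
    ... | a , b , refl , refl , Kab = to (adj⇔ a b) Kab

∈-copies⇔ : ∀ {k n} (K : Graph k) (G : Mat n) {s : Sub n} →
  s ∈ copies K G ⇔ (∃ λ φ → IsEmbedding (adj K) G φ × s ≡ image (adj K) φ)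
∈-copies⇔ {k} {n} K G = mk⇔ decode encode
  where
  decode : ∀ {s} → s ∈ copies K G → ∃ λ φ → IsEmbedding (adj K) G φ × s ≡ image (adj K) φ
  decode {S , E} s∈copies
    with to (isCopyᵇ⇔ {K = K} {G}) (proj₂ (∈-filter⁻ (T? ∘ isCopyᵇ K G) {xs = allSubs n} s∈copies))
  ... | sub , φ , iso = φ , emb , isIsoOnto⇒≡image sub iso
    where
    emb : IsEmbedding (adj K) G φ
    emb = record
      { injective   = IsIsoOnto.injective iso
      ; homomorphic = λ {a} {b} Kab → IsSubgraph.edge⇒adj sub (to (IsIsoOnto.adj⇔ iso a b) Kab)
      }
  encode : ∀ {s} → (∃ λ φ → IsEmbedding (adj K) G φ × s ≡ image (adj K) φ) → s ∈ copies K G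
  encode (φ , emb , refl) = ∈-filter⁺ (T? ∘ isCopyᵇ K G) (∈-allSubs _) (from (isCopyᵇ⇔ {K = K} {G})
    (image-isSubgraph (Graph-isGraph K) emb , φ , image-isIsoOnto (IsEmbedding.injective emb)))

embedding⇒copies≢[] : ∀ {k n} {K : Graph k} {G : Mat n} {φ} → IsEmbedding (adj K) G φ → copies K G ≢ []
embedding⇒copies≢[] {K = K} {G} {φ} emb copies≡[] =
  ¬Any[] (subst (image (adj K) φ ∈_) copies≡[] (from (∈-copies⇔ K G) (φ , emb , refl)))

vsubsetᵇ-image : ∀ {k l n} {K : Mat k} {L : Mat l} {φ : Vec (Fin n) k} {ψ : Vec (Fin n) l} →
  T (vsubsetᵇ (image K φ) (image L ψ)) → ∀ a → ∃ λ b → lookup ψ b ≡ lookup φ a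
vsubsetᵇ-image {φ = φ} {ψ} t a = to (∈-vertices ψ _)
  (to T-⇒ᵇ (to (T-allFin _) t (lookup φ a)) (from (∈-vertices φ _) (a , refl)))

copies⊆images : ∀ {k n} (K : Graph k) (G : Mat n) {s} →
  s ∈ copies K G → s ∈ map (image (adj K)) (allVecs (allFin n) k)
copies⊆images {k} {n} K G = image∈images ∘ to (∈-copies⇔ K G)
  where
  image∈images : ∀ {s} → (∃ λ φ → IsEmbedding (adj K) G φ × s ≡ image (adj K) φ) →
    s ∈ map (image (adj K)) (allVecs (allFin n) k)
  image∈images (φ , _ , refl) = ∈-map⁺ (image (adj K)) (∈-allVecs (allFin n) φ (λ _ → ∈-allFin _))

length-copies≤ : ∀ {k n} (K : Graph k) (G : Mat n) → length (copies K G) ≤ n ^ k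
length-copies≤ {k} {n} K G = begin
  length (copies K G)
    ≤⟨ unique-⊆⇒length≤ (copies-unique K G) (copies⊆images K G) ⟩
  length (map (image (adj K)) (allVecs (allFin n) k))  ≡⟨ length-map _ (allVecs (allFin n) k) ⟩
  length (allVecs (allFin n) k)                        ≡⟨ length-allVecs (allFin n) k ⟩
  length (allFin n) ^ k                                ≡⟨ cong (_^ k) (length-allFin n) ⟩
  n ^ k                                                ∎
  where open ≤-Reasoning

exre≤n^h : ∀ {h f} n (H : Graph h) (F : Graph f) → exre n H F ≤ n ^ h
exre≤n^h {h} n H F = foldr-⊔-lub (map (Nreᴹ H F) (allGraphMats n)) Nre≤n^h
  where
  Nre≤n^h : ∀ {x} → x ∈ map (Nreᴹ H F) (allGraphMats n) → x ≤ n ^ h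
  Nre≤n^h = Nre≤ ∘ ∈-map⁻ (Nreᴹ H F)
    where
    Nre≤ : ∀ {x} → (∃ λ G → G ∈ allGraphMats n × x ≡ Nreᴹ H F G) → x ≤ n ^ h
    Nre≤ (G , _ , refl) = ≤-trans (length-filter _ (copies H G)) (length-copies≤ H G)

Nre≤exre : ∀ {h f n} (H : Graph h) (F : Graph f) {G : Mat n} → IsGraph G → Nreᴹ H F G ≤ exre n H F
Nre≤exre H F {G} graph =
  ∈⇒≤foldr-⊔ (∈-map⁺ (Nreᴹ H F) (∈-filter⁺ (T? ∘ isGraphᵇ) (∈-allMats G) (from isGraphᵇ⇔ graph)))

-- The blow-up of H

module BlowUp {h} {{_ : NonZero h}} (H : Graph h) (n : ℕ) where

  m : ℕ
  m = n / h

  part : Fin n → Fin h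
  part i = toℕ i mod h

  blowUp : Mat n
  blowUp = tabulateMat λ i j → entry (adj H) (part i) (part j)

  Adj-blowUp : ∀ i j → Adj blowUp i j ⇔ Adj (adj H) (part i) (part j)
  Adj-blowUp i j rewrite entry-tabulateMat (λ i j → entry (adj H) (part i) (part j)) i j = ⇔-refl

  blowUp-isGraph : IsGraph blowUp
  blowUp-isGraph = record
    { irreflexive = λ i → irreflexive (part i) ∘ to (Adj-blowUp i i)
    ; symmetric   = λ {i} {j} → from (Adj-blowUp j i) ∘ symmetric ∘ to (Adj-blowUp i j)
    }
    where open IsGraph (Graph-isGraph H)

  vertex : Fin h → Fin m → Fin n
  vertex a x = inject≤ (combine x a) (m/n*n≤m n h)

  part-vertex : ∀ a x → part (vertex a x) ≡ a
  part-vertex a x = toℕ-injective (begin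
    toℕ (part (vertex a x))  ≡⟨ toℕ-fromℕ< _ ⟩
    toℕ (vertex a x) % h     ≡⟨ cong (_% h) (trans (toℕ-inject≤ _ _) (toℕ-combine x a)) ⟩
    (h * toℕ x + toℕ a) % h  ≡⟨ %-remove-+ˡ (toℕ a) (m∣m*n (toℕ x)) ⟩
    toℕ a % h                ≡⟨ m<n⇒m%n≡m (toℕ<n a) ⟩
    toℕ a                    ∎)
    where open ≡-Reasoning

  vertex-injectiveʳ : ∀ a {x y} → vertex a x ≡ vertex a y → x ≡ y
  vertex-injectiveʳ a {x} {y} eq = combine-injectiveˡ x a y a (inject≤-injective _ _ _ _ eq)

  transversal : Vec (Fin m) h → Vec (Fin n) h
  transversal τ = tabulate λ a → vertex a (lookup τ a)

  part-transversal : ∀ τ a → part (lookup (transversal τ) a) ≡ a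
  part-transversal τ a = trans (cong part (lookup∘tabulate _ a)) (part-vertex a (lookup τ a))

  transversal-isEmbedding : ∀ τ → IsEmbedding (adj H) blowUp (transversal τ)
  transversal-isEmbedding τ = record
    { injective   = λ {a} {b} eq →
        trans (sym (part-transversal τ a)) (trans (cong part eq) (part-transversal τ b))
    ; homomorphic = λ {a} {b} Hab → from (Adj-blowUp _ _)
        (subst₂ (Adj (adj H)) (sym (part-transversal τ a)) (sym (part-transversal τ b)) Hab)
    }

  transversalCopy : Vec (Fin m) h → Sub n
  transversalCopy τ = image (adj H) (transversal τ)

  transversalCopy-injective : Injective _≡_ _≡_ transversalCopy
  transversalCopy-injective {τ} {τ′} eq =
    lookup-extensionality λ a → τa≡τ′a a (to (∈-vertices (transversal τ′) _) (∈τ′ a))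
    where
    ∈τ′ : ∀ a → lookup (transversal τ) a ∈ᵛ vertices (transversal τ′)
    ∈τ′ a = subst (lookup (transversal τ) a ∈ᵛ_) (cong proj₁ eq)
                  (from (∈-vertices (transversal τ) _) (a , refl))
    τa≡τ′a : ∀ a → (∃ λ a′ → lookup (transversal τ′) a′ ≡ lookup (transversal τ) a) →
      lookup τ a ≡ lookup τ′ a
    τa≡τ′a a (a′ , eq′)
      with trans (sym (part-transversal τ′ a′)) (trans (cong part eq′) (part-transversal τ a))
    ... | refl = vertex-injectiveʳ a
      (trans (sym (lookup∘tabulate _ a)) (trans (sym eq′) (lookup∘tabulate _ a)))

  module _ {f} (F : Graph f) (f≤h : f ≤ h) (F⊄H : copies F (adj H) ≡ []) where

    projection-isEmbedding : ∀ τ {ψ} → IsEmbedding (adj F) blowUp ψ →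
      (∀ b → ∃ λ a → lookup (transversal τ) a ≡ lookup ψ b) → IsEmbedding (adj F) (adj H) (Vec.map part ψ)
    projection-isEmbedding τ {ψ} emb ψ⊆φ = record
      { injective   = λ {b} {b′} eq → injective
          (ψ-injective-on-parts b b′ (trans (sym (lookup-map b part ψ)) (trans eq (lookup-map b′ part ψ))))
      ; homomorphic = λ {b} {b′} Fbb′ →
          subst₂ (Adj (adj H)) (sym (lookup-map b part ψ)) (sym (lookup-map b′ part ψ))
                 (to (Adj-blowUp _ _) (homomorphic Fbb′))
      }
      where
      open IsEmbedding emb
      ψ-injective-on-parts : ∀ b b′ → part (lookup ψ b) ≡ part (lookup ψ b′) → lookup ψ b ≡ lookup ψ b′
      ψ-injective-on-parts b b′ eq with ψ⊆φ b | ψ⊆φ b′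
      ... | a , φa≡ψb | a′ , φa′≡ψb′ = begin
        lookup ψ b                ≡⟨ sym φa≡ψb ⟩
        lookup (transversal τ) a  ≡⟨ cong (lookup (transversal τ)) a≡a′ ⟩
        lookup (transversal τ) a′ ≡⟨ φa′≡ψb′ ⟩
        lookup ψ b′               ∎
        where
        open ≡-Reasoning
        a≡a′ : a ≡ a′
        a≡a′ = begin
          a                                ≡⟨ sym (part-transversal τ a) ⟩
          part (lookup (transversal τ) a)  ≡⟨ cong part φa≡ψb ⟩
          part (lookup ψ b)                ≡⟨ eq ⟩
          part (lookup ψ b′)               ≡⟨ cong part (sym φa′≡ψb′) ⟩
          part (lookup (transversal τ) a′) ≡⟨ part-transversal τ a′ ⟩
          a′                               ∎

    transversalCopy-nonaligned : ∀ τ {d} → d ∈ copies F blowUp → ¬ T (alignᵇ (transversalCopy τ) d)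
    transversalCopy-nonaligned τ = image-nonaligned ∘ to (∈-copies⇔ F blowUp)
      where
      φ = transversal τ
      image-nonaligned : ∀ {d} → (∃ λ ψ → IsEmbedding (adj F) blowUp ψ × d ≡ image (adj F) ψ) →
        ¬ T (alignᵇ (transversalCopy τ) d)
      image-nonaligned (ψ , emb , refl) aligned =
        embedding⇒copies≢[] {K = F} (projection-isEmbedding τ emb ψ⊆φ) F⊄H
        where
        ψ⊆φ : ∀ b → ∃ λ a → lookup φ a ≡ lookup ψ b
        ψ⊆φ with to (T-∨ {vsubsetᵇ (transversalCopy τ) (image (adj F) ψ)}) aligned
        ... | inj₁ φ⊆ψ = ⊆-image⇒⊇-image f≤h (IsEmbedding.injective (transversal-isEmbedding τ))
                           (vsubsetᵇ-image {K = adj H} {adj F} {φ} {ψ} φ⊆ψ)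
        ... | inj₂ ψ⊆φ = vsubsetᵇ-image {K = adj F} {adj H} {ψ} {φ} ψ⊆φ

    m^h≤Nre : m ^ h ≤ Nreᴹ H F blowUp
    m^h≤Nre = begin
      m ^ h                                                ≡⟨ cong (_^ h) (sym (length-allFin m)) ⟩
      length (allFin m) ^ h                                ≡⟨ sym (length-allVecs (allFin m) h) ⟩
      length (allVecs (allFin m) h)                        ≡⟨ sym (length-map transversalCopy (allVecs _ h)) ⟩
      length (map transversalCopy (allVecs (allFin m) h))
        ≤⟨ unique-⊆⇒length≤ transversalCopies-unique transversalCopies⊆counted ⟩
      Nreᴹ H F blowUp                                      ∎
      where
      open ≤-Reasoning
      transversalCopies-unique : Unique (map transversalCopy (allVecs (allFin m) h))
      transversalCopies-unique =
        Unique.map⁺ transversalCopy-injective (allVecs-unique (allFin m) (Unique.allFin⁺ m) h)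
      Counted : Sub n → Set
      Counted c = c ∈ filterᵇ (λ c → not (any (alignᵇ c) (copies F blowUp))) (copies H blowUp)
      transversalCopy-counted : ∀ τ → Counted (transversalCopy τ)
      transversalCopy-counted τ = ∈-filter⁺ _
        (from (∈-copies⇔ H blowUp) (transversal τ , transversal-isEmbedding τ , refl))
        (T-not-any (transversalCopy-nonaligned τ))
      transversalCopies⊆counted : ∀ {c} → c ∈ map transversalCopy (allVecs (allFin m) h) → Counted c
      transversalCopies⊆counted c∈ = let (τ , _ , c≡τ) = ∈-map⁻ transversalCopy c∈ in
        subst Counted (sym c≡τ) (transversalCopy-counted τ)

    m^h≤exre : m ^ h ≤ exre n H F
    m^h≤exre = ≤-trans m^h≤Nre (Nre≤exre H F blowUp-isGraph)

^-distribʳ-* : ∀ x y k → (x * y) ^ k ≡ x ^ k * y ^ k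
^-distribʳ-* x y zero    = refl
^-distribʳ-* x y (suc k) = trans (cong (x * y *_) (^-distribʳ-* x y k))
  (solve 4 (λ x y a b → (x :* y) :* (a :* b) := (x :* a) :* (y :* b)) refl x y (x ^ k) (y ^ k))
  where open +-*-Solver

n≤2h*[n/h] : ∀ {h n} .{{_ : NonZero h}} → h ≤ n → n ≤ 2 * h * (n / h)
n≤2h*[n/h] {h} {n} h≤n = begin
  n                      ≡⟨ m≡m%n+[m/n]*n n h ⟩
  n % h + n / h * h      ≤⟨ +-monoˡ-≤ (n / h * h) (≤-trans (<⇒≤ (m%n<n n h)) h≤[n/h]*h) ⟩
  n / h * h + n / h * h  ≡⟨ solve 2 (λ q h → q :* h :+ q :* h := con 2 :* h :* q) refl (n / h) h ⟩
  2 * h * (n / h)        ∎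
  where
  open ≤-Reasoning
  open +-*-Solver
  h≤[n/h]*h : h ≤ n / h * h
  h≤[n/h]*h = m≤n*m h (n / h) {{>-nonZero (m≥n⇒m/n>0 h≤n)}}

mainTheorem1 : ∀ {h f} (H : Graph h) (F : Graph f) → f ≤ h → copies F (adj H) ≡ [] →
    Σ ℕ λ c → Σ ℕ λ C → Σ ℕ λ N → ∀ n → N ≤ n →
      (n ^ h ≤ c * exre n H F) × (exre n H F ≤ C * n ^ h)
mainTheorem1 {zero} H F z≤n F⊄H = ⊥-elim (embedding⇒copies≢[] {K = F} emptyEmbedding F⊄H)
  where
  emptyEmbedding : IsEmbedding (adj F) (adj H) []
  emptyEmbedding = record { injective = λ { {()} } ; homomorphic = λ { {()} } }
mainTheorem1 {h@(suc _)} H F f≤h F⊄H = (2 * h) ^ h , 1 , h , λ n h≤n → lower n h≤n , upper n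
  where
  upper : ∀ n → exre n H F ≤ 1 * n ^ h
  upper n = ≤-trans (exre≤n^h n H F) (≤-reflexive (sym (*-identityˡ _)))
  lower : ∀ n → h ≤ n → n ^ h ≤ (2 * h) ^ h * exre n H F
  lower n h≤n = begin
    n ^ h                      ≤⟨ ^-monoˡ-≤ h (n≤2h*[n/h] h≤n) ⟩
    (2 * h * (n / h)) ^ h      ≡⟨ ^-distribʳ-* (2 * h) (n / h) h ⟩
    (2 * h) ^ h * (n / h) ^ h  ≤⟨ *-monoʳ-≤ ((2 * h) ^ h) (BlowUp.m^h≤exre H n F f≤h F⊄H) ⟩
    (2 * h) ^ h * exre n H F   ∎
    where open ≤-Reasoning
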